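{- For any tree $T$ with at least two vertices, $\dim(L(T)) \le Z(L(T))$.
   Context: All graphs are finite and simple. $L(T)$ is the line graph of $T$. For a graph $H$, $W \subseteq V(H)$ is a resolving set if for every pair of distinct vertices $u,v$ some $x \in W$ has $d(u,x) \ne d(v,x)$ ($d$ the shortest-path distance); $\dim(H)$ is the minimum size of a resolving set (equal to $0$ if $H$ has one vertex). Zero forcing: each vertex is colored black or white; if a black vertex $u$ has exactly one white neighbor $w$, then $w$ becomes black. $S \subseteq V(H)$ is a zero forcing set if starting with exactly $S$ black, repeated application of this rule makes all vertices black; $Z(H)$ is the minimum size of a zero forcing set. -}

module Defs where

open import Data.Nat using (ℕ; zero; suc; _≤_; _<ᵇ_)
open import Data.Fin using (Fin; toℕ)
open import Data.Bool using (Bool; true; false; _∧_; T)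
open import Data.List using (List; []; _∷_; length; _∷ʳ_)
open import Data.List.Membership.Propositional using (_∈_)
open import Data.List.Relation.Unary.Unique.Propositional using (Unique)
open import Data.List.Relation.Unary.Linked using (Linked)
open import Data.Product using (Σ; ∃; _×_; _,_)
open import Data.Sum using (_⊎_)
open import Relation.Binary.PropositionalEquality using (_≡_; _≢_)
open import Relation.Nullary using (¬_)

record Graph : Set₁ where
  field
    V   : Set
    Adj : V → V → Set

module _ (G : Graph) where
  open Graph G

  data Walk : V → V → ℕ → Set where
    here : ∀ {u} → Walk u u zero
    step : ∀ {u w v k} → Adj u w → Walk w v k → Walk u v (suc k)

  -- d(u,v) = k  (shortest-path distance; no k exists if disconnected)
  Dist : V → V → ℕ → Set
  Dist u v k = Walk u v k × (∀ m → Walk u v m → k ≤ m)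

  Resolving : List V → Set
  Resolving W = ∀ u v → u ≢ v →
    ∃ λ x → x ∈ W × ∃ λ k → Dist u x k × ¬ Dist v x k

  IsMetricDim : ℕ → Set
  IsMetricDim d =
    (∃ λ W → Unique W × Resolving W × length W ≡ d) ×
    (∀ W → Unique W → Resolving W → d ≤ length W)

  -- vertices eventually coloured black when exactly S is black initially
  -- (closure under the colour-change rule: a black u all of whose
  --  neighbours other than w are black forces w)
  data Black (S : List V) : V → Set where
    init  : ∀ {x} → x ∈ S → Black S x
    force : ∀ {u w} → Black S u → Adj u w →
            (∀ y → Adj u y → y ≢ w → Black S y) → Black S w

  ZeroForcing : List V → Set
  ZeroForcing S = ∀ v → Black S v

  IsZeroForcingNum : ℕ → Set
  IsZeroForcingNum z =
    (∃ λ S → Unique S × ZeroForcing S × length S ≡ z) ×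
    (∀ S → Unique S → ZeroForcing S → z ≤ length S)

record SimpleGraph (n : ℕ) : Set where
  field
    adj   : Fin n → Fin n → Bool
    sym   : ∀ i j → adj i j ≡ adj j i
    irrefl : ∀ i → adj i i ≡ false

module _ {n : ℕ} (G : SimpleGraph n) where
  open SimpleGraph G

  Adjacent : Fin n → Fin n → Set
  Adjacent i j = T (adj i j)

  Connected : Set
  Connected = ∀ u v → ∃ λ k → Walk (record { V = Fin n ; Adj = Adjacent }) u v k

  -- a cycle: distinct vertices x, v₁, …, vₘ, y (m ≥ 1, so ≥ 3 vertices),
  -- consecutive ones adjacent, and y adjacent to x
  HasCycle : Set
  HasCycle = ∃ λ x → ∃ λ xs → ∃ λ y →
    Unique (x ∷ xs ∷ʳ y) × Linked Adjacent (x ∷ xs ∷ʳ y) ×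
    1 ≤ length xs × Adjacent y x

  IsTree : Set
  IsTree = Connected × ¬ HasCycle

  Edge : Set
  Edge = Σ (Fin n × Fin n) λ { (i , j) → T ((toℕ i <ᵇ toℕ j) ∧ adj i j) }

  ShareEndpoint : Edge → Edge → Set
  ShareEndpoint ((a , b) , _) ((c , d) , _) =
    a ≡ c ⊎ a ≡ d ⊎ b ≡ c ⊎ b ≡ d

  LineGraph : Graph
  LineGraph = record
    { V   = Edge
    ; Adj = λ e f → e ≢ f × ShareEndpoint e f }

-- If S does not resolve u ≠ v, then every x ∈ S is equidistant from u and v. The equidistant
-- edges are closed under the colour-change rule, so when S is zero forcing every edge is
-- equidistant, u included, and d(u,v) = d(u,u) = 0. Closure is where the tree is used. Let x be
-- at distance a+1 from u and y a neighbour of x at distance a, sharing the vertex c with x. A walk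
-- from another neighbour of x to u has to enter the branch of T at c containing u, so it passes
-- through y if the neighbour contains c and through x otherwise: y is the only neighbour of x at
-- distance ≤ a, and the others are at distance a+1 or a+2 according as they contain c. Hence the
-- distances of the neighbours of x are determined by y; if all neighbours but w are equidistant,
-- the neighbours of x toward u and toward v coincide, and w is equidistant as well.

module Submission where

open import Defs
open import Data.Bool using (true; false; T; _∧_)
open import Data.Bool.Properties using (T-∧; T-irrelevant)
open import Data.Empty using (⊥-elim)
open import Data.Fin using (Fin; toℕ)
open import Data.Fin.Properties using (_≟_; toℕ-injective; any?)
open import Data.List using (List; []; _∷_; _∷ʳ_)
open import Data.List.Properties using (∷-injectiveˡ; ∷-injectiveʳ)
open import Data.List.Membership.Propositional using (_∈_; find; lose)
open import Data.List.Relation.Unary.All using (All; []; _∷_)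
open import Data.List.Relation.Unary.All.Properties using (¬Any⇒All¬)
open import Data.List.Relation.Unary.Any using (here; there)
import Data.List.Relation.Unary.Any as Any
open import Data.List.Relation.Unary.Linked using (Linked; []; [-]; _∷_)
open import Data.List.Relation.Unary.AllPairs using ([]; _∷_)
open import Data.List.Relation.Unary.Unique.Propositional using (Unique)
open import Data.Nat using (ℕ; zero; suc; _+_; _<ᵇ_; _≤_; _<_; z≤n; s≤s)
  renaming (_≟_ to _≟ℕ_)
open import Data.Nat.Properties
  using ( ≤-antisym; ≤-trans; ≤-reflexive; ≤-pred; ≮⇒≥; n≤0⇒n≡0; 1+n≰n; n≤1+n; m≤n⇒m≤1+n
        ; m<1+n⇒m<n∨m≡n; +-suc; +-identityʳ; <-cmp; <⇒<ᵇ; <ᵇ⇒<; <-asym )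
open import Data.Product using (Σ; ∃; _×_; _,_; proj₁; proj₂)
open import Data.Sum using (_⊎_; inj₁; inj₂)
open import Data.Unit using (tt)
open import Function using (_∘_; Equivalence)
open import Relation.Binary.Definitions using (DecidableEquality; tri<; tri≈; tri>)
open import Relation.Binary.PropositionalEquality using (_≡_; _≢_; refl; sym; trans; cong; subst)
open import Relation.Nullary using (¬_; Dec; yes; no)
open import Relation.Nullary.Decidable using (map′; _⊎-dec_; _×-dec_; ¬?; decidable-stable)
import Relation.Unary as U

Least : (ℕ → Set) → ℕ → Set
Least P m = P m × (∀ k → P k → m ≤ k)

module _ {P : ℕ → Set} (P? : U.Decidable P) where

  private
    search : ∀ fuel m → (∀ {j} → j < m → ¬ P j) → P (fuel + m) → ∃ (Least P)
    search fuel m below p with P? m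
    ... | yes pm = m , pm , λ k pk → ≮⇒≥ λ k<m → below k<m pk
    search zero m below p | no ¬pm = ⊥-elim (¬pm p)
    search (suc fuel) m below p | no ¬pm =
      search fuel (suc m) below′ (subst P (sym (+-suc fuel m)) p)
      where
        below′ : ∀ {j} → j < suc m → ¬ P j
        below′ j<1+m with m<1+n⇒m<n∨m≡n j<1+m
        ... | inj₁ j<m = below j<m
        ... | inj₂ refl = ¬pm

  least : ∀ {k} → P k → ∃ (Least P)
  least {k} p = search k 0 (λ ()) (subst P (sym (+-identityʳ k)) p)

module _ {n : ℕ} (G : SimpleGraph n) where

  open SimpleGraph G using (adj) renaming (sym to adj-sym; irrefl to adj-irrefl)

  private
    V = Fin n
    E = Edge G
    L = LineGraph G

    _~_ : V → V → Set
    _~_ = Adjacent G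

    _~ᴸ_ : E → E → Set
    _~ᴸ_ = Graph.Adj L

  ~-sym : ∀ {a b} → a ~ b → b ~ a
  ~-sym {a} {b} = subst T (adj-sym a b)

  ~-irrefl : ∀ {a} → ¬ a ~ a
  ~-irrefl {a} = subst T (adj-irrefl a)

  ~⇒≢ : ∀ {a b} → a ~ b → a ≢ b
  ~⇒≢ a~a refl = ~-irrefl a~a

  infix 4 _∈ₑ_
  _∈ₑ_ : V → E → Set
  t ∈ₑ ((i , j) , _) = t ≡ i ⊎ t ≡ j

  _∈ₑ?_ : ∀ t e → Dec (t ∈ₑ e)
  t ∈ₑ? ((i , j) , _) = t ≟ i ⊎-dec t ≟ j

  private
    edge-~ : ∀ {i j} → T ((toℕ i <ᵇ toℕ j) ∧ adj i j) → i ~ j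
    edge-~ = proj₂ ∘ Equivalence.to T-∧

    edge-< : ∀ {i j} → T ((toℕ i <ᵇ toℕ j) ∧ adj i j) → toℕ i < toℕ j
    edge-< {i} {j} = <ᵇ⇒< (toℕ i) (toℕ j) ∘ proj₁ ∘ Equivalence.to T-∧

  endpoints-adjacent : ∀ {a b} e → a ∈ₑ e → b ∈ₑ e → a ≢ b → a ~ b
  endpoints-adjacent e (inj₁ refl) (inj₁ refl) a≢b = ⊥-elim (a≢b refl)
  endpoints-adjacent (_ , p) (inj₁ refl) (inj₂ refl) _ = edge-~ p
  endpoints-adjacent (_ , p) (inj₂ refl) (inj₁ refl) _ = ~-sym (edge-~ p)
  endpoints-adjacent e (inj₂ refl) (inj₂ refl) a≢b = ⊥-elim (a≢b refl)

  other-endpoint : ∀ e c → ∃ λ t → t ∈ₑ e × t ≢ c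
  other-endpoint ((i , j) , p) c with i ≟ c
  ... | no i≢c = i , inj₁ refl , i≢c
  ... | yes refl = j , inj₂ refl , λ j≡i → ~⇒≢ (edge-~ p) (sym j≡i)

  _≟ₑ_ : DecidableEquality E
  ((i , j) , p) ≟ₑ ((k , l) , q) with i ≟ k | j ≟ l
  ... | yes refl | yes refl = yes (cong ((i , j) ,_) (T-irrelevant p q))
  ... | no i≢k   | _        = no λ { refl → i≢k refl }
  ... | yes _    | no j≢l   = no λ { refl → j≢l refl }

  -- Edges are stored as (i , j) with i < j, which rules out the crossed matchings.
  endpoints⇒≡ : ∀ {a b} e f → a ≢ b → a ∈ₑ e → b ∈ₑ e → a ∈ₑ f → b ∈ₑ f → e ≡ f
  endpoints⇒≡ e f a≢b (inj₁ refl) (inj₁ refl) _ _ = ⊥-elim (a≢b refl)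
  endpoints⇒≡ e f a≢b (inj₂ refl) (inj₂ refl) _ _ = ⊥-elim (a≢b refl)
  endpoints⇒≡ e f a≢b _ _ (inj₁ refl) (inj₁ refl) = ⊥-elim (a≢b refl)
  endpoints⇒≡ e f a≢b _ _ (inj₂ refl) (inj₂ refl) = ⊥-elim (a≢b refl)
  endpoints⇒≡ (_ , p) (_ , q) _ (inj₁ refl) (inj₂ refl) (inj₁ refl) (inj₂ refl) =
    cong (_ ,_) (T-irrelevant p q)
  endpoints⇒≡ (_ , p) (_ , q) _ (inj₂ refl) (inj₁ refl) (inj₂ refl) (inj₁ refl) =
    cong (_ ,_) (T-irrelevant p q)
  endpoints⇒≡ (_ , p) (_ , q) _ (inj₁ refl) (inj₂ refl) (inj₂ refl) (inj₁ refl) =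
    ⊥-elim (<-asym (edge-< p) (edge-< q))
  endpoints⇒≡ (_ , p) (_ , q) _ (inj₂ refl) (inj₁ refl) (inj₁ refl) (inj₂ refl) =
    ⊥-elim (<-asym (edge-< p) (edge-< q))

  shared-endpoint : ∀ e f → ShareEndpoint G e f → ∃ λ c → c ∈ₑ e × c ∈ₑ f
  shared-endpoint _ _ (inj₁ refl) = _ , inj₁ refl , inj₁ refl
  shared-endpoint _ _ (inj₂ (inj₁ refl)) = _ , inj₁ refl , inj₂ refl
  shared-endpoint _ _ (inj₂ (inj₂ (inj₁ refl))) = _ , inj₂ refl , inj₁ refl
  shared-endpoint _ _ (inj₂ (inj₂ (inj₂ refl))) = _ , inj₂ refl , inj₂ refl

  common⇒ShareEndpoint : ∀ {c} e f → c ∈ₑ e → c ∈ₑ f → ShareEndpoint G e f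
  common⇒ShareEndpoint _ _ (inj₁ refl) (inj₁ refl) = inj₁ refl
  common⇒ShareEndpoint _ _ (inj₁ refl) (inj₂ refl) = inj₂ (inj₁ refl)
  common⇒ShareEndpoint _ _ (inj₂ refl) (inj₁ refl) = inj₂ (inj₂ (inj₁ refl))
  common⇒ShareEndpoint _ _ (inj₂ refl) (inj₂ refl) = inj₂ (inj₂ (inj₂ refl))

  common⇒≡⊎~ᴸ : ∀ {c} e f → c ∈ₑ e → c ∈ₑ f → e ≡ f ⊎ e ~ᴸ f
  common⇒≡⊎~ᴸ e f c∈e c∈f with e ≟ₑ f
  ... | yes e≡f = inj₁ e≡f
  ... | no e≢f = inj₂ (e≢f , common⇒ShareEndpoint e f c∈e c∈f)

  ~ᴸ-sym : ∀ {e f} → e ~ᴸ f → f ~ᴸ e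
  ~ᴸ-sym {e} {f} (e≢f , shared) =
    let c , c∈e , c∈f = shared-endpoint e f shared
    in e≢f ∘ sym , common⇒ShareEndpoint f e c∈f c∈e

  _~ᴸ?_ : ∀ e f → Dec (e ~ᴸ f)
  ((i , j) , p) ~ᴸ? ((k , l) , q) =
    ¬? (((i , j) , p) ≟ₑ ((k , l) , q)) ×-dec (i ≟ k ⊎-dec i ≟ l ⊎-dec j ≟ k ⊎-dec j ≟ l)

  edge-of : ∀ {a b} → a ~ b → ∃ λ e → a ∈ₑ e × b ∈ₑ e
  edge-of {a} {b} a~b with <-cmp (toℕ a) (toℕ b)
  ... | tri< a<b _ _ = ((a , b) , Equivalence.from T-∧ (<⇒<ᵇ a<b , a~b)) , inj₁ refl , inj₂ refl
  ... | tri≈ _ a≡b _ = ⊥-elim (~⇒≢ a~b (toℕ-injective a≡b))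
  ... | tri> _ _ b<a =
    ((b , a) , Equivalence.from T-∧ (<⇒<ᵇ b<a , ~-sym a~b)) , inj₂ refl , inj₁ refl

  private
    Σ-T? : ∀ b {Q : T b → Set} → (∀ t → Dec (Q t)) → Dec (Σ (T b) Q)
    Σ-T? true  Q? = map′ (tt ,_) proj₂ (Q? tt)
    Σ-T? false Q? = no proj₁

  ∃ₑ? : {P : E → Set} → (∀ e → Dec (P e)) → Dec (∃ P)
  ∃ₑ? P? = map′ (λ (i , j , t , q) → _ , q) (λ (((i , j) , t) , q) → i , j , t , q)
                 (any? λ i → any? λ j → Σ-T? _ λ t → P? ((i , j) , t))

  walkᴸ? : ∀ k e f → Dec (Walk L e f k)
  walkᴸ? zero    e f = map′ (λ { refl → here }) (λ { here → refl }) (e ≟ₑ f)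
  walkᴸ? (suc k) e f =
    map′ (λ (g , e~g , w) → step e~g w) (λ { (step e~g w) → _ , e~g , w })
         (∃ₑ? λ g → e ~ᴸ? g ×-dec walkᴸ? k g f)

  walk-snoc : ∀ {e f g k} → Walk L e f k → f ~ᴸ g → Walk L e g (suc k)
  walk-snoc here         f~g = step f~g here
  walk-snoc (step e~e′ w) f~g = step e~e′ (walk-snoc w f~g)

  walk-reverse : ∀ {e f k} → Walk L e f k → Walk L f e k
  walk-reverse here         = here
  walk-reverse (step e~e′ w) = walk-snoc (walk-reverse w) (~ᴸ-sym e~e′)

  data PathAvoiding (c a : V) : V → Set where
    start  : a ≢ c → PathAvoiding c a a
    extend : ∀ {m b} → PathAvoiding c a m → m ~ b → b ≢ c → PathAvoiding c a b

  along-edge : ∀ {c r m t} e → m ∈ₑ e → t ∈ₑ e → t ≢ c → PathAvoiding c r m → PathAvoiding c r t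
  along-edge {m = m} {t} e m∈e t∈e t≢c p with m ≟ t
  ... | yes refl = p
  ... | no m≢t = extend p (endpoints-adjacent e m∈e t∈e m≢t) t≢c

  -- The branch of G at c containing r is the component of G − c containing r.
  InBranch : V → V → E → Set
  InBranch c r e = ∀ {t} → t ∈ₑ e → t ≢ c → PathAvoiding c r t

  OutOfBranch : V → V → E → Set
  OutOfBranch c r e = ∀ {t} → t ∈ₑ e → t ≢ c → ¬ PathAvoiding c r t

  InBranch-endpoint : ∀ {c r} e → r ∈ₑ e → r ≢ c → InBranch c r e
  InBranch-endpoint e r∈e r≢c t∈e t≢c = along-edge e r∈e t∈e t≢c (start r≢c)

  -- xs lists the vertices of a path from a to the head of xs, in reverse order
  SimplePathAvoiding : V → V → List V → Set
  SimplePathAvoiding c a xs =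
    Unique xs × Linked _~_ xs × All (c ≢_) xs × ∃ λ prefix → xs ≡ prefix ∷ʳ a

  private
    SimplePathAvoiding-tail : ∀ {c a x y ys} →
      SimplePathAvoiding c a (x ∷ y ∷ ys) → SimplePathAvoiding c a (y ∷ ys)
    SimplePathAvoiding-tail (_ ∷ distinct , _ ∷ linked , _ ∷ avoids , prefix , eq) =
      distinct , linked , avoids , ends prefix eq
      where
        ends : ∀ prefix → _ ∷ _ ∷ _ ≡ prefix ∷ʳ _ → ∃ λ prefix′ → _ ≡ prefix′ ∷ʳ _
        ends [] ()
        ends (_ ∷ prefix′) eq = prefix′ , ∷-injectiveʳ eq

    suffix-from : ∀ {c a b xs} → b ∈ xs → SimplePathAvoiding c a xs →
                  ∃ λ rest → SimplePathAvoiding c a (b ∷ rest)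
    suffix-from (here refl) p = _ , p
    suffix-from {xs = _ ∷ _ ∷ _} (there b∈xs) p =
      suffix-from b∈xs (SimplePathAvoiding-tail p)

  loop-erase : ∀ {c a b} → PathAvoiding c a b → ∃ λ rest → SimplePathAvoiding c a (b ∷ rest)
  loop-erase (start a≢c) = [] , [] ∷ [] , [-] , (a≢c ∘ sym) ∷ [] , [] , refl
  loop-erase {b = b} (extend {m} p m~b b≢c) with loop-erase p
  ... | rest , sp with Any.any? (b ≟_) (m ∷ rest)
  ...   | yes b∈ = suffix-from b∈ sp
  ...   | no b∉ = let distinct , linked , avoids , prefix , eq = sp in
                  m ∷ rest , ¬Any⇒All¬ _ b∉ ∷ distinct , ~-sym m~b ∷ linked ,
                  (b≢c ∘ sym) ∷ avoids , b ∷ prefix , cong (b ∷_) eq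

  module _ (acyclic : ¬ HasCycle G) where

    neighbours-disconnected : ∀ {c r s} → c ~ r → c ~ s → r ≢ s → ¬ PathAvoiding c r s
    neighbours-disconnected {c} {r} c~r c~s r≢s p with loop-erase p
    ... | _ , _ , _ , _ , [] , eq = r≢s (sym (∷-injectiveˡ eq))
    ... | _ , distinct , linked , avoids , y ∷ ys , eq =
      acyclic (c , y ∷ ys , r , subst (Unique ∘ (c ∷_)) eq (avoids ∷ distinct) ,
               subst (Linked _~_ ∘ (c ∷_)) eq (c~s ∷ linked) , s≤s z≤n , ~-sym c~r)

    sibling-OutOfBranch : ∀ {c r y z} → c ∈ₑ z → r ∈ₑ z → r ≢ c → c ∈ₑ y → y ≢ z →
                          OutOfBranch c r y
    sibling-OutOfBranch {r = r} {y} {z} c∈z r∈z r≢c c∈y y≢z {t} t∈y t≢c p with t ≟ r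
    ... | yes refl = y≢z (endpoints⇒≡ y z r≢c t∈y c∈y r∈z c∈z)
    ... | no t≢r = neighbours-disconnected (endpoints-adjacent z c∈z r∈z (r≢c ∘ sym))
                     (endpoints-adjacent y c∈y t∈y (t≢c ∘ sym)) (t≢r ∘ sym) p

  module _ (connected : Connected G) where

    private
      prepend : ∀ {e g f} → e ≡ g ⊎ e ~ᴸ g → ∃ (Walk L g f) → ∃ (Walk L e f)
      prepend (inj₁ refl) w       = w
      prepend (inj₂ e~g)  (k , w) = suc k , step e~g w

      lift-walk : ∀ {a b k} → Walk (record { V = V ; Adj = _~_ }) a b k →
                  ∀ {e f} → a ∈ₑ e → b ∈ₑ f → ∃ (Walk L e f)
      lift-walk here a∈e a∈f = prepend (common⇒≡⊎~ᴸ _ _ a∈e a∈f) (0 , here)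
      lift-walk (step a~a′ w) a∈e b∈f =
        let g , a∈g , a′∈g = edge-of a~a′
        in prepend (common⇒≡⊎~ᴸ _ g a∈e a∈g) (lift-walk w a′∈g b∈f)

    lineGraph-connected : ∀ e f → ∃ (Walk L e f)
    lineGraph-connected ((a , _) , _) ((b , _) , _) =
      lift-walk (proj₂ (connected a b)) (inj₁ refl) (inj₁ refl)

    -- Dist L e f is literally Least (Walk L e f), so the least number principle yields it.
    shortest : ∀ e f → ∃ (Dist L e f)
    shortest e f = least (λ k → walkᴸ? k e f) (proj₂ (lineGraph-connected e f))

    dist : E → E → ℕ
    dist e f = proj₁ (shortest e f)

    dist-Dist : ∀ e f → Dist L e f (dist e f)
    dist-Dist e f = proj₂ (shortest e f)

    dist-walk : ∀ e f → Walk L e f (dist e f)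
    dist-walk e f = proj₁ (dist-Dist e f)

    dist-≤ : ∀ {e f k} → Walk L e f k → dist e f ≤ k
    dist-≤ {e} {f} w = proj₂ (dist-Dist e f) _ w

    Dist⇒≡dist : ∀ {e f k} → Dist L e f k → k ≡ dist e f
    Dist⇒≡dist (w , minimal) = ≤-antisym (minimal _ (dist-walk _ _)) (dist-≤ w)

    Dist-sym : ∀ {e f k} → Dist L e f k → Dist L f e k
    Dist-sym (w , minimal) = walk-reverse w , λ m w′ → minimal m (walk-reverse w′)

    dist-~ᴸ : ∀ {e e′ f} → e ~ᴸ e′ → dist e f ≤ suc (dist e′ f)
    dist-~ᴸ e~e′ = dist-≤ (step e~e′ (dist-walk _ _))

    dist-self : ∀ e → dist e e ≡ 0
    dist-self e = n≤0⇒n≡0 (dist-≤ {e} here)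

    dist≡0⇒≡ : ∀ {e f} → dist e f ≡ 0 → e ≡ f
    dist≡0⇒≡ {e} {f} d≡0 with dist e f | dist-walk e f
    dist≡0⇒≡ refl | zero | here = refl

    dist-predecessor : ∀ {e f a} → dist e f ≡ suc a → ∃ λ e′ → e ~ᴸ e′ × dist e′ f ≡ a
    dist-predecessor {e} {f} d≡1+a with dist e f | dist-walk e f | dist-≤ {e} {f}
    dist-predecessor refl | suc a | step e~e′ w | minimal =
      _ , e~e′ , ≤-antisym (dist-≤ w) (≤-pred (minimal (step e~e′ (dist-walk _ _))))

    dist-≤-common : ∀ {c e e′ f k} → c ∈ₑ e → c ∈ₑ e′ → Walk L e′ f k → dist e f ≤ suc k
    dist-≤-common {e = e} {e′} c∈e c∈e′ w with common⇒≡⊎~ᴸ e e′ c∈e c∈e′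
    ... | inj₁ refl = m≤n⇒m≤1+n (dist-≤ w)
    ... | inj₂ e~e′ = dist-≤ (step e~e′ w)

    -- A walk to h shorter than dist x h cannot meet an edge at c ∈ x, so it stays in the branch.
    InBranch-preserved : ∀ {c r x g h k} → c ∈ₑ x → InBranch c r g → Walk L g h k →
                         suc k ≤ dist x h → InBranch c r h
    InBranch-preserved _ in-g here _ = in-g
    InBranch-preserved {c} {g = g} c∈x in-g (step {w = g′} g~g′ w) k<d
      with shared-endpoint g g′ (proj₂ g~g′)
    ... | m , m∈g , m∈g′ with m ≟ c
    ...   | yes refl = ⊥-elim (1+n≰n (≤-trans k<d (dist-≤-common c∈x m∈g′ w)))
    ...   | no m≢c = InBranch-preserved c∈x in-g′ w (≤-trans (n≤1+n _) k<d)
      where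
        in-g′ : InBranch c _ g′
        in-g′ t∈g′ t≢c = along-edge g′ m∈g′ t∈g′ t≢c (in-g m∈g m≢c)

    module _ (acyclic : ¬ HasCycle G) where

      -- Every walk from outside the branch at c containing r into it passes through the edge cr.
      crossing-bound : ∀ {c r z g h k} → c ∈ₑ z → r ∈ₑ z → r ≢ c →
                       OutOfBranch c r g → InBranch c r h → Walk L g h k → suc (dist z h) ≤ k
      crossing-bound {c} {h = h} _ _ _ out-g in-h here =
        let t , t∈h , t≢c = other-endpoint h c in ⊥-elim (out-g t∈h t≢c (in-h t∈h t≢c))
      crossing-bound {c} {r} {z} {g} c∈z r∈z r≢c out-g in-h (step {w = g′} g~g′ w)
        with g′ ≟ₑ z
      ... | yes refl = s≤s (dist-≤ w)
      ... | no g′≢z = m≤n⇒m≤1+n (crossing-bound c∈z r∈z r≢c out-g′ in-h w)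
        where
          out-g′ : OutOfBranch c r g′
          out-g′ with shared-endpoint g g′ (proj₂ g~g′)
          ... | m , m∈g , m∈g′ with m ≟ c
          ...   | yes refl = sibling-OutOfBranch acyclic c∈z r∈z r≢c m∈g′ g′≢z
          ...   | no m≢c = λ t∈g′ t≢c p → out-g m∈g m≢c (along-edge g′ t∈g′ m∈g′ m≢c p)

      module Gate (u : E) {x y : E} (x~y : x ~ᴸ y) {c : V} (c∈x : c ∈ₑ x) (c∈y : c ∈ₑ y)
                  {a : ℕ} (dx : dist x u ≡ suc a) (dy : dist y u ≡ a) where

        private
          u-in-branch : ∀ {p s} → p ∈ₑ x → InBranch p s y → InBranch p s u
          u-in-branch p∈x in-y =
            InBranch-preserved p∈x in-y (dist-walk y u)
              (≤-reflexive (trans (cong suc dy) (sym dx)))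

          lower-through : ∀ {y′} → y′ ≢ y → c ∈ₑ y′ → suc a ≤ dist y′ u
          lower-through {y′} y′≢y c∈y′ with other-endpoint y c
          ... | r , r∈y , r≢c =
            subst (λ k → suc k ≤ dist y′ u) dy
              (crossing-bound c∈y r∈y r≢c
                 (sibling-OutOfBranch acyclic c∈y r∈y r≢c c∈y′ y′≢y)
                 (u-in-branch c∈x (InBranch-endpoint y r∈y r≢c))
                 (dist-walk y′ u))

          lower-away : ∀ {y′} → x ~ᴸ y′ → ¬ c ∈ₑ y′ → suc (suc a) ≤ dist y′ u
          lower-away {y′} x~y′ c∉y′ with shared-endpoint x y′ (proj₂ x~y′)
          ... | q , q∈x , q∈y′ =
            subst (λ k → suc k ≤ dist y′ u) dx
              (crossing-bound q∈x c∈x c≢q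
                 (sibling-OutOfBranch acyclic q∈x c∈x c≢q q∈y′ (proj₁ x~y′ ∘ sym))
                 (u-in-branch q∈x (InBranch-endpoint y c∈y c≢q))
                 (dist-walk y′ u))
            where
              c≢q : c ≢ q
              c≢q refl = c∉y′ q∈y′

        dist-through : ∀ {y′} → y′ ≢ y → c ∈ₑ y′ → dist y′ u ≡ suc a
        dist-through {y′} y′≢y c∈y′ =
          ≤-antisym (subst (λ k → dist y′ u ≤ suc k) dy (dist-~ᴸ y′~y)) (lower-through y′≢y c∈y′)
          where
            y′~y = y′≢y , common⇒ShareEndpoint y′ y c∈y′ c∈y

        dist-away : ∀ {y′} → x ~ᴸ y′ → ¬ c ∈ₑ y′ → dist y′ u ≡ suc (suc a)
        dist-away {y′} x~y′ c∉y′ =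
          ≤-antisym (subst (λ k → dist y′ u ≤ suc k) dx (dist-~ᴸ (~ᴸ-sym x~y′)))
                    (lower-away x~y′ c∉y′)

        closer-unique : ∀ {y′} → x ~ᴸ y′ → dist y′ u ≤ a → y′ ≡ y
        closer-unique {y′} x~y′ d≤a with y′ ≟ₑ y | c ∈ₑ? y′
        ... | yes y′≡y | _        = y′≡y
        ... | no y′≢y  | yes c∈y′ = ⊥-elim (1+n≰n (≤-trans (lower-through y′≢y c∈y′) d≤a))
        ... | no _     | no c∉y′  =
          ⊥-elim (1+n≰n (≤-trans (lower-away x~y′ c∉y′) (m≤n⇒m≤1+n d≤a)))

      closer-neighbour-unique : ∀ {u x y a} → x ~ᴸ y → dist x u ≡ suc a → dist y u ≡ a →
                                ∀ {y′} → x ~ᴸ y′ → dist y′ u ≤ a → y′ ≡ y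
      closer-neighbour-unique {u} {x} {y} x~y dx dy with shared-endpoint x y (proj₂ x~y)
      ... | c , c∈x , c∈y = Gate.closer-unique u x~y c∈x c∈y dx dy

      same-gate⇒equidistant : ∀ {u v x y a} → x ~ᴸ y →
        dist x u ≡ suc a → dist y u ≡ a → dist x v ≡ suc a → dist y v ≡ a →
        ∀ {w} → x ~ᴸ w → dist w u ≡ dist w v
      same-gate⇒equidistant {u} {v} {x} {y} x~y dxu dyu dxv dyv {w} x~w
        with shared-endpoint x y (proj₂ x~y)
      ... | c , c∈x , c∈y = by-cases (w ≟ₑ y) (c ∈ₑ? w)
        where
          module Gu = Gate u x~y c∈x c∈y dxu dyu
          module Gv = Gate v x~y c∈x c∈y dxv dyv
          by-cases : Dec (w ≡ y) → Dec (c ∈ₑ w) → dist w u ≡ dist w v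
          by-cases (yes w≡y)  _        =
            subst (λ e → dist e u ≡ dist e v) (sym w≡y) (trans dyu (sym dyv))
          by-cases (no w≢y)  (yes c∈w) =
            trans (Gu.dist-through w≢y c∈w) (sym (Gv.dist-through w≢y c∈w))
          by-cases (no _)    (no c∉w)  =
            trans (Gu.dist-away x~w c∉w) (sym (Gv.dist-away x~w c∉w))

      Equidistant : E → E → E → Set
      Equidistant u v g = dist g u ≡ dist g v

      module _ {u v : E} (u≢v : u ≢ v) where

        -- The closer neighbours y (toward u) and y′ (toward v) of x coincide: whichever of them is
        -- not w is equidistant, hence is also closer to the other target.
        Equidistant-forced : ∀ {x w} → x ~ᴸ w → Equidistant u v x →
                             (∀ y → x ~ᴸ y → y ≢ w → Equidistant u v y) → Equidistant u v w
        Equidistant-forced {x} {w} x~w x-eq others = by-cases (dist x u) refl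
          where
            by-cases : ∀ d → dist x u ≡ d → Equidistant u v w
            by-cases zero dxu =
              ⊥-elim (u≢v (trans (sym (dist≡0⇒≡ {x} dxu)) (dist≡0⇒≡ {x} (trans (sym x-eq) dxu))))
            by-cases (suc a) dxu with dist-predecessor dxu | dist-predecessor (trans (sym x-eq) dxu)
            ... | y , x~y , dyu | y′ , x~y′ , dy′v =
              same-gate⇒equidistant x~y dxu dyu dxv (subst (λ e → dist e v ≡ a) y′≡y dy′v) x~w
              where
                dxv = trans (sym x-eq) dxu
                y′≡y : y′ ≡ y
                y′≡y with y ≟ₑ w | y′ ≟ₑ y
                ... | _ | yes y′≡y = y′≡y
                ... | no y≢w | no _ =
                  sym (closer-neighbour-unique x~y′ dxv dy′v x~y
                         (≤-reflexive (trans (sym (others y x~y y≢w)) dyu)))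
                ... | yes y≡w | no y′≢y =
                  closer-neighbour-unique x~y dxu dyu x~y′
                    (≤-reflexive (trans (others y′ x~y′ y′≢w) dy′v))
                  where
                    y′≢w : y′ ≢ w
                    y′≢w y′≡w = y′≢y (trans y′≡w (sym y≡w))

        Black⇒Equidistant : ∀ {S w} → (∀ {x} → x ∈ S → Equidistant u v x) →
                            Black L S w → Equidistant u v w
        Black⇒Equidistant S-eq (init x∈S) = S-eq x∈S
        Black⇒Equidistant S-eq (force b x~w others) =
          Equidistant-forced x~w (Black⇒Equidistant S-eq b)
            (λ y x~y y≢w → Black⇒Equidistant S-eq (others y x~y y≢w))

      zeroForcing⇒resolving : ∀ {S} → ZeroForcing L S → Resolving L S
      zeroForcing⇒resolving {S} zf u v u≢v with Any.any? (λ x → ¬? (dist x u ≟ℕ dist x v)) S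
      ... | yes separating =
        let x , x∈S , x-separates = find separating
        in x , x∈S , dist x u , Dist-sym (dist-Dist x u) , x-separates ∘ Dist⇒≡dist ∘ Dist-sym
      ... | no none =
        ⊥-elim (u≢v (dist≡0⇒≡ (trans (sym (Black⇒Equidistant u≢v S-eq (zf u))) (dist-self u))))
        where
          S-eq : ∀ {x} → x ∈ S → Equidistant u v x
          S-eq {x} x∈S = decidable-stable (dist x u ≟ℕ dist x v) (none ∘ lose x∈S)

corollary4p2 : (n : ℕ) → 2 ≤ n → (T : SimpleGraph n) → IsTree T →
               (d z : ℕ) → IsMetricDim (LineGraph T) d →
               IsZeroForcingNum (LineGraph T) z → d ≤ z
corollary4p2 _ _ T (connected , acyclic) d z (_ , dim-minimal)
             ((S , S-unique , S-forcing , |S|≡z) , _) =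
  subst (d ≤_) |S|≡z
    (dim-minimal S S-unique (zeroForcing⇒resolving T connected acyclic S-forcing))
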